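{- Assuming excluded middle, function extensionality, and propositional extensionality, there is an automorphism $f:\mathcal{U}\to\mathcal{U}$ (an equivalence from $\mathcal{U}$ to itself) such that $f(\mathbf{1})\simeq\mathbf{0}$.
   Context: Work in intensional Martin-Löf type theory with $\Pi$-, $\Sigma$-, identity, finite types and natural numbers, and a universe $\mathcal{U}$ closed under these. A type is a proposition if any two of its elements are equal. Excluded middle: for every proposition $P:\mathcal{U}$, $P+\neg P$, where $\neg P$ is $P\to\mathbf{0}$. Propositional extensionality: any two logically equivalent propositions (propositions $P,Q$ with maps $P\to Q$ and $Q\to P$) are equal. An equivalence is a map with a left and a right inverse; $A\simeq B$ means there is an equivalence $A\to B$. -}

module Defs where

open import Level using (Level; _⊔_; suc; Setω)
open import Data.Product using (Σ; _×_)
open import Data.Sum using (_⊎_)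
open import Data.Empty using (⊥)
open import Relation.Nullary using (¬_)
open import Relation.Binary.PropositionalEquality using (_≡_)

isProp : ∀ {ℓ} → Set ℓ → Set ℓ
isProp P = (x y : P) → x ≡ y

ExcludedMiddle : Set₁
ExcludedMiddle = (P : Set) → isProp P → P ⊎ ¬ P

FunExt : Setω
FunExt = ∀ {a b : Level} {A : Set a} {B : A → Set b} (f g : (x : A) → B x)
         → ((x : A) → f x ≡ g x) → f ≡ g

PropExt : Set₁
PropExt = (P Q : Set) → isProp P → isProp Q → (P → Q) → (Q → P) → P ≡ Q

isEquiv : ∀ {a b} {A : Set a} {B : Set b} → (A → B) → Set (a ⊔ b)
isEquiv {A = A} {B} f =
  (Σ (B → A) λ g → (x : A) → g (f x) ≡ x) × (Σ (B → A) λ h → (y : B) → f (h y) ≡ y)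

_≃_ : ∀ {a b} → Set a → Set b → Set (a ⊔ b)
A ≃ B = Σ (A → B) isEquiv

-- Negating propositions and fixing every other type is an involution of the
-- universe: excluded middle decides which branch applies, negations are again
-- propositions, and double negation is the identity on propositions by excluded
-- middle and propositional extensionality. Being its own inverse it is an
-- equivalence, and it sends the proposition ⊤ to ¬ ⊤, which is empty.
module Submission where

open import Defs
open import Axiom.UniquenessOfIdentityProofs using (UIP; module Constant⇒UIP)
open import Data.Product using (Σ; _×_; _,_)
open import Data.Unit using (⊤; tt)
open import Data.Empty using (⊥; ⊥-elim)
open import Data.Sum using (_⊎_; inj₁; inj₂)
open import Relation.Nullary using (¬_)
open import Relation.Binary.PropositionalEquality using (_≡_; refl; sym; subst; module ≡-Reasoning)

isProp⇒UIP : {A : Set} → isProp A → UIP A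
isProp⇒UIP A-prop = Constant⇒UIP.≡-irrelevant (λ {x} {y} _ → A-prop x y) (λ _ _ → refl)

isProp-isProp : FunExt → (A : Set) → isProp (isProp A)
isProp-isProp fe A p q =
  fe p q λ x → fe (p x) (q x) λ y → isProp⇒UIP p (p x y) (q x y)

¬-isProp : FunExt → (A : Set) → isProp (¬ A)
¬-isProp fe A u v = fe u v λ x → ⊥-elim (u x)

¬¬-≡ : ExcludedMiddle → FunExt → PropExt → {P : Set} → isProp P → (¬ ¬ P) ≡ P
¬¬-≡ lem fe pe {P} P-prop =
  pe (¬ ¬ P) P (¬-isProp fe (¬ P)) P-prop (stable (lem P P-prop)) (λ p ¬p → ¬p p)
  where
  stable : P ⊎ ¬ P → ¬ ¬ P → P
  stable (inj₁ p)  _   = p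
  stable (inj₂ ¬p) ¬¬p = ⊥-elim (¬¬p ¬p)

involutive⇒isEquiv : ∀ {a} {A : Set a} {f : A → A} → (∀ x → f (f x) ≡ x) → isEquiv f
involutive⇒isEquiv {f = f} f∘f≡id = (f , f∘f≡id) , (f , f∘f≡id)

¬⊤≃⊥ : FunExt → (¬ ⊤) ≃ ⊥
¬⊤≃⊥ fe = (λ ¬⊤ → ¬⊤ tt) , (⊥-elim , λ ¬⊤ → fe _ _ λ _ → ⊥-elim (¬⊤ tt)) , (⊥-elim , λ ())

negateIf : (A : Set) → isProp A ⊎ ¬ isProp A → Set
negateIf A (inj₁ _) = ¬ A
negateIf A (inj₂ _) = A

module _ (lem : ExcludedMiddle) (fe : FunExt) where

  negateProps : Set → Set
  negateProps A = negateIf A (lem (isProp A) (isProp-isProp fe A))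

  negateProps-prop : {A : Set} → isProp A → negateProps A ≡ (¬ A)
  negateProps-prop {A} A-prop with lem (isProp A) (isProp-isProp fe A)
  ... | inj₁ _       = refl
  ... | inj₂ ¬A-prop = ⊥-elim (¬A-prop A-prop)

  negateProps-nonProp : {A : Set} → ¬ isProp A → negateProps A ≡ A
  negateProps-nonProp {A} ¬A-prop with lem (isProp A) (isProp-isProp fe A)
  ... | inj₁ A-prop = ⊥-elim (¬A-prop A-prop)
  ... | inj₂ _      = refl

  negateProps-involutive : PropExt → (A : Set) → negateProps (negateProps A) ≡ A
  negateProps-involutive pe A = byCases (lem (isProp A) (isProp-isProp fe A))
    where
    byCases : (d : isProp A ⊎ ¬ isProp A) → negateProps (negateIf A d) ≡ A
    byCases (inj₁ A-prop) = begin
      negateProps (¬ A) ≡⟨ negateProps-prop (¬-isProp fe A) ⟩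
      ¬ ¬ A             ≡⟨ ¬¬-≡ lem fe pe A-prop ⟩
      A                 ∎
      where open ≡-Reasoning
    byCases (inj₂ ¬A-prop) = negateProps-nonProp ¬A-prop

theorem3p1 : ExcludedMiddle → FunExt → PropExt
    → Σ (Set → Set) λ f → isEquiv f × (f ⊤ ≃ ⊥)
theorem3p1 lem fe pe =
  negateProps lem fe ,
  involutive⇒isEquiv (negateProps-involutive lem fe pe) ,
  subst (_≃ ⊥) (sym (negateProps-prop lem fe ⊤-prop)) (¬⊤≃⊥ fe)
  where
  ⊤-prop : isProp ⊤
  ⊤-prop tt tt = refl
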